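{- Let $m\in\mathbb N_{\ge1}$. There exists a number $N(m)\le(2m+1)\uparrow\uparrow5$ such that for every $\varepsilon>0$ there is no deterministic $(m-\varepsilon)$-competitive online algorithm for Online Makespan Hypergraph Coloring with $m$ colors, even when restricted to hyperforests with $N(m)$ nodes in which every hyperedge has at most $m$ nodes.
   Context: Online Makespan Hypergraph Coloring with $m$ colors: a hypergraph $\mathcal H=(V,E)$ with nodes $V=[n]$ is revealed online; nodes are revealed in the order $1,2,\dots,n$, and when node $j$ is revealed the algorithm learns the partial hyperedges $e\cap[j]$ for all $e\in E$, and must then irrevocably assign $j$ a color $c(j)\in[m]$. The objective (makespan) is $\max_{i\in[m]}\max_{e\in E}|c^{ -1}(i)\cap e|$, to be minimized. A deterministic online algorithm is $r$-competitive if on every instance its objective value is at most $r$ times the minimum objective over all colorings $[n]\to[m]$. A hypercycle is a sequence $v_1,e_1,v_2,\dots,e_\ell,v_{\ell+1}=v_1$ with pairwise distinct hyperedges $e_t$ such that $v_t,v_{t+1}\in e_t$; a hyperforest is a hypergraph without hypercycle. Notation: $x\uparrow\uparrow5=x^{x^{x^{x^{x}}}}$ (tower of height 5). -}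

module Defs where

open import Data.Nat using (ℕ; zero; suc; _+_; _*_; _^_; _≤_; _⊔_; _⊓_)
open import Data.Nat.Properties using ()
open import Data.Bool using (Bool; true; false; if_then_else_; _∧_; _∨_)
open import Data.Fin using (Fin; toℕ; inject≤; inject₁; fromℕ) renaming (zero to fzero; suc to fsuc)
open import Data.Fin.Properties using (toℕ<n)
import Data.Fin as F
open import Data.Vec using (Vec; []; _∷_; lookup; tabulate)
open import Data.List using (List; []; _∷_; map; foldr; concatMap; allFin; filterᵇ; length)
open import Data.Nat.ListAction using (sum)
open import Data.Empty using (⊥)
import Data.List as L
open import Data.Product using (Σ; _×_; _,_)
open import Relation.Nullary using (does)
open import Relation.Binary.PropositionalEquality using (_≡_)
open import Function.Definitions using (Injective)
open import Data.Integer using (+_)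
open import Data.Rational using (ℚ; _/_)

tower5 : ℕ → ℕ
tower5 x = x ^ (x ^ (x ^ (x ^ x)))

ℕ→ℚ : ℕ → ℚ
ℕ→ℚ n = (+ n) / 1

-- Hypergraphs on node set V = {0,…,n-1} (node j is the (j+1)-th revealed).

Edge : ℕ → Set
Edge n = Vec Bool n

Hypergraph : ℕ → Set
Hypergraph n = List (Edge n)

_∈ₑ_ : ∀ {n} → Fin n → Edge n → Set
v ∈ₑ e = lookup e v ≡ true

countIn : ∀ {n} → Edge n → (Fin n → Bool) → ℕ
countIn {n} e p = sum (map (λ k → if lookup e k ∧ p k then 1 else 0) (allFin n))

size : ∀ {n} → Edge n → ℕ
size e = countIn e (λ _ → true)

EdgesAtMost : ∀ {n} → ℕ → Hypergraph n → Set
EdgesAtMost {n} m E = ∀ (i : Fin (length E)) → size (L.lookup E i) ≤ m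

-- A hypercycle (Berge cycle) of length ℓ ≥ 2:
-- v₁, e₁, v₂, …, e_ℓ, v_{ℓ+1} = v₁ with pairwise distinct vertices v₁,…,v_ℓ,
-- pairwise distinct hyperedges e₁,…,e_ℓ (distinct positions in the edge list),
-- and v_t, v_{t+1} ∈ e_t.
record Hypercycle {n} (E : Hypergraph n) : Set where
  field
    ℓ      : ℕ
    ℓ≥2    : 2 ≤ ℓ
    vs     : Fin (suc ℓ) → Fin n
    es     : Fin ℓ → Fin (length E)
    closed : vs (fromℕ ℓ) ≡ vs fzero
    vs-inj : Injective _≡_ _≡_ (λ (t : Fin ℓ) → vs (inject₁ t))
    es-inj : Injective _≡_ _≡_ es
    left   : ∀ (t : Fin ℓ) → vs (inject₁ t) ∈ₑ L.lookup E (es t)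
    right  : ∀ (t : Fin ℓ) → vs (fsuc t) ∈ₑ L.lookup E (es t)

IsHyperforest : ∀ {n} → Hypergraph n → Set
IsHyperforest E = Hypercycle E → ⊥

Coloring : ℕ → ℕ → Set
Coloring n m = Vec (Fin m) n

load : ∀ {n m} → Coloring n m → Fin m → Edge n → ℕ
load c i e = countIn e (λ k → does (lookup c k F.≟ i))

makespan : ∀ {n m} → Hypergraph n → Coloring n m → ℕ
makespan {n} {m} E c =
  foldr _⊔_ 0 (map (λ i → foldr _⊔_ 0 (map (load c i) E)) (allFin m))

allColorings : ∀ n m → List (Coloring n m)
allColorings zero    m = [] ∷ []
allColorings (suc n) m =
  concatMap (λ c → map (λ x → x ∷ c) (allFin m)) (allColorings n m)

-- minimum of a list (0 for the empty list; the list is nonempty for m ≥ 1)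
minList : List ℕ → ℕ
minList []           = 0
minList (x ∷ [])     = x
minList (x ∷ y ∷ xs) = x ⊓ minList (y ∷ xs)

OPT : ∀ {n} (m : ℕ) → Hypergraph n → ℕ
OPT {n} m E = minList (map (makespan E) (allColorings n m))

truncate : ∀ {n} (j : Fin n) → Edge n → Vec Bool (suc (toℕ j))
truncate j e = tabulate (λ i → lookup e (inject≤ i (toℕ<n j)))

nonempty : ∀ {k} → Vec Bool k → Bool
nonempty []       = false
nonempty (b ∷ bs) = b ∨ nonempty bs

-- What the algorithm knows when node j (0-based) is revealed:
-- the nonempty partial hyperedges e ∩ [j+1] for e ∈ E (in the order of E,
-- so the identity of each hyperedge is tracked over time).
View : ℕ → Set
View j = List (Vec Bool (suc j))

view : ∀ {n} → Hypergraph n → (j : Fin n) → View (toℕ j)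
view E j = filterᵇ nonempty (map (truncate j) E)

-- A deterministic online algorithm with m colors: the color of node j is a
-- function of the information revealed up to (and including) node j.
-- (Earlier views are truncations of the current one, so the algorithm's own
-- previous choices are recomputable from it.)
OnlineAlg : ℕ → Set
OnlineAlg m = (j : ℕ) → View j → Fin m

runAlg : ∀ {n m} → OnlineAlg m → Hypergraph n → Coloring n m
runAlg A E = tabulate (λ j → A (toℕ j) (view E j))

ALG : ∀ {n m} → OnlineAlg m → Hypergraph n → ℕ
ALG A E = makespan E (runAlg A E)

-- The adversary grows a hyperforest node by node: node i founds edge i and may
-- join earlier edges, but only edges lying in different components, so no hypercycle arises.
-- For a demand vector v with entries below m, it forces a color x and an edge of size v x + 1
-- that the algorithm colored entirely x, by induction on Σ v: for each color c with v c > 0 it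
-- recurses with v c lowered by one, which either already succeeds with a color x ≠ c or yields
-- an all-c edge of size v c; a last node then joins all these edges, and whatever color x it
-- gets, either the x-edge grows to v x + 1 or v x = 0 and the node alone suffices. With
-- v = (m-1, …, m-1) this gives ALG ≥ m. Alongside, an offline coloring is kept rainbow on
-- every edge, swapping colors inside each recursive region so that the last node can take the
-- top color; hence OPT ≤ 1 and no ratio below m is possible.

module Submission where

open import Defs
open import Data.Nat using (ℕ; zero; suc; _+_; _*_; _∸_; _^_; _<_; _≤_; _⊔_; _≡ᵇ_; z≤n; s≤s; _<?_; _≤?_; NonZero)
open import Data.Nat.Properties
open import Data.Nat.DivMod using (_mod_; m<n⇒m%n≡m)
open import Data.Nat.Coprimality using (1-coprimeTo) renaming (sym to coprime-sym)
open import Data.Nat.ListAction using () renaming (sum to sumᴸ)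
open import Data.Bool using (Bool; true; false; if_then_else_; _∧_; _∨_)
open import Data.Bool.Properties using (∧-identityʳ; ∨-zeroʳ; T-≡)
open import Data.Bool.ListAction using (any)
open import Data.Fin using (Fin; toℕ; inject₁; inject≤; fromℕ; fromℕ<) renaming (zero to fzero; suc to fsuc)
import Data.Fin as F
open import Data.Fin.Properties using (toℕ-injective; toℕ-fromℕ<; toℕ-fromℕ; toℕ-inject₁; toℕ-inject≤; toℕ<n; fromℕ<-toℕ)
open import Data.Fin.Permutation using (Permutation′; _⟨$⟩ʳ_; _⟨$⟩ˡ_; inverseʳ; inverseˡ; transpose)
open import Data.Vec using (Vec; []; _∷_; lookup; tabulate; replicate; sum; _[_]≔_)
open import Data.Vec.Properties using (lookup∘tabulate; lookup-replicate; lookup∘update; lookup∘update′)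
import Data.Vec.Properties as Vec
open import Data.List using (List; []; _∷_; length; map; foldr; allFin; filterᵇ)
import Data.List as L
open import Data.List.Properties using (map-tabulate; length-tabulate)
import Data.List.Properties as List
open import Data.List.Relation.Unary.All as All using (All; []; _∷_)
open import Data.List.Relation.Unary.Any as Any using (Any; here; there)
open import Data.List.Relation.Unary.Any.Properties using (any⁺; any⁻)
open import Data.List.Relation.Unary.AllPairs using (AllPairs; []; _∷_)
open import Data.List.Membership.Propositional using (_∈_; find; lose)
open import Data.List.Membership.Propositional.Properties using (∈-allFin; ∈-map⁺; ∈-concatMap⁺; ∈-tabulate⁺; ∈-tabulate⁻)
open import Data.Empty using (⊥; ⊥-elim)
open import Data.Product using (Σ; _×_; _,_; proj₁; proj₂)
open import Data.Sum using (_⊎_; inj₁; inj₂)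
import Data.Integer as ℤ
import Data.Integer.Properties as ℤᵖ
open import Data.Rational using (ℚ; Positive; _-_; *≤*; *<*) renaming (_≤_ to _≤ℚ_; _<_ to _<ℚ_; _*_ to _*ℚ_)
import Data.Rational.Properties as ℚ
open import Function using (_∘_)
open import Function.Bundles using (Equivalence)
open import Relation.Binary.PropositionalEquality using (_≡_; _≢_; refl; sym; trans; cong; cong₂; subst; subst₂)
open import Relation.Binary.Definitions using (tri<; tri≈; tri>)
open import Relation.Nullary using (¬_; does; yes; no)
open import Relation.Nullary.Decidable using (dec-true; dec-false)

indicator : Bool → ℕ
indicator b = if b then 1 else 0

count : (ℕ → Bool) → ℕ → ℕ
count p zero    = 0
count p (suc n) = count p n + indicator (p n)

count-cong : ∀ {p q} n → (∀ k → k < n → p k ≡ q k) → count p n ≡ count q n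
count-cong zero    p≗q = refl
count-cong (suc n) p≗q =
  cong₂ _+_ (count-cong n (λ k k<n → p≗q k (m<n⇒m<1+n k<n))) (cong indicator (p≗q n ≤-refl))

count-stable : ∀ {p a b} → a ≤ b → (∀ k → a ≤ k → k < b → p k ≡ false) → count p b ≡ count p a
count-stable {b = zero}  z≤n _ = refl
count-stable {p} {a} {suc b} a≤1+b off with m≤n⇒m<n∨m≡n a≤1+b
... | inj₂ refl = refl
... | inj₁ a<1+b rewrite off b (≤-pred a<1+b) ≤-refl =
  trans (+-identityʳ _) (count-stable (≤-pred a<1+b) (λ k a≤k k<b → off k a≤k (m<n⇒m<1+n k<b)))

count-none : ∀ {p} n → (∀ k → k < n → p k ≡ false) → count p n ≡ 0
count-none n none = count-stable z≤n (λ k _ k<n → none k k<n)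

indicator≤1 : ∀ b → indicator b ≤ 1
indicator≤1 true  = ≤-refl
indicator≤1 false = z≤n

count-shift : ∀ p n → count p (suc n) ≡ indicator (p 0) + count (λ k → p (suc k)) n
count-shift p zero    = +-comm 0 _
count-shift p (suc n) = trans (cong (_+ indicator (p (suc n))) (count-shift p n))
                              (+-assoc (indicator (p 0)) _ _)

sum-tabulate-indicator : ∀ n (p : ℕ → Bool) →
  sumᴸ (L.tabulate {n = n} (λ k → indicator (p (toℕ k)))) ≡ count p n
sum-tabulate-indicator zero    p = refl
sum-tabulate-indicator (suc n) p =
  trans (cong (indicator (p 0) +_) (sum-tabulate-indicator n (λ k → p (suc k)))) (sym (count-shift p n))

countIn≡count : ∀ {n} (e : Edge n) (q : Fin n → Bool) (p : ℕ → Bool) →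
  (∀ k → (lookup e k ∧ q k) ≡ p (toℕ k)) → countIn e q ≡ count p n
countIn≡count {n} e q p agree =
  trans (cong sumᴸ (trans (map-tabulate (λ k → k) _) (List.tabulate-cong (λ k → cong indicator (agree k)))))
        (sum-tabulate-indicator n p)

≤-max : ∀ {X : Set} (f : X → ℕ) {xs a} → a ∈ xs → f a ≤ foldr _⊔_ 0 (map f xs)
≤-max f (here refl) = m≤m⊔n _ _
≤-max f (there a∈) = ≤-trans (≤-max f a∈) (m≤n⊔m _ _)

max-≤ : ∀ {X : Set} (f : X → ℕ) xs {b} → (∀ a → a ∈ xs → f a ≤ b) → foldr _⊔_ 0 (map f xs) ≤ b
max-≤ f []       bound = z≤n
max-≤ f (x ∷ xs) bound = ⊔-lub (bound x (here refl)) (max-≤ f xs (λ a a∈ → bound a (there a∈)))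

load≤makespan : ∀ {n m} (E : Hypergraph n) (c : Coloring n m) i {e} → e ∈ E → load c i e ≤ makespan E c
load≤makespan E c i e∈ = ≤-trans (≤-max (load c i) e∈) (≤-max _ (∈-allFin i))

makespan-≤ : ∀ {n m} (E : Hypergraph n) (c : Coloring n m) {b} →
  (∀ i e → e ∈ E → load c i e ≤ b) → makespan E c ≤ b
makespan-≤ {m = m} E c bound = max-≤ _ (allFin m) (λ i _ → max-≤ (load c i) E (bound i))

minList-≤ : ∀ xs {a} → a ∈ xs → minList xs ≤ a
minList-≤ (x ∷ [])     (here refl) = ≤-refl
minList-≤ (x ∷ y ∷ xs) (here refl) = m⊓n≤m _ _
minList-≤ (x ∷ y ∷ xs) (there a∈)  = ≤-trans (m⊓n≤n _ _) (minList-≤ (y ∷ xs) a∈)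

∈-allColorings : ∀ n m (c : Coloring n m) → c ∈ allColorings n m
∈-allColorings zero    m []      = here refl
∈-allColorings (suc n) m (x ∷ c) = ∈-concatMap⁺ (λ c′ → map (λ y → y ∷ c′) (allFin m))
  (Any.map (λ { refl → ∈-map⁺ (λ y → y ∷ c) (∈-allFin x) }) (∈-allColorings n m c))

OPT≤makespan : ∀ {n} m (E : Hypergraph n) (c : Coloring n m) → OPT m E ≤ makespan E c
OPT≤makespan {n} m E c = minList-≤ _ (∈-map⁺ (makespan E) (∈-allColorings n m c))

ℕ→ℚ-mono-≤ : ∀ {a b} → a ≤ b → ℕ→ℚ a ≤ℚ ℕ→ℚ b
ℕ→ℚ-mono-≤ {a} {b} a≤b
  rewrite ℚ.normalize-coprime (coprime-sym (1-coprimeTo a))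
        | ℚ.normalize-coprime (coprime-sym (1-coprimeTo b)) =
  *≤* (subst₂ ℤ._≤_ (sym (ℤᵖ.*-identityʳ (ℤ.+ a))) (sym (ℤᵖ.*-identityʳ (ℤ.+ b))) (ℤ.+≤+ a≤b))

m≤a⇒o≤1⇒a≰[m-ε]*o : ∀ {m a o} (ε : ℚ) → Positive ε → 1 ≤ m → m ≤ a → o ≤ 1 →
  ¬ ℕ→ℚ a ≤ℚ (ℕ→ℚ m - ε) *ℚ ℕ→ℚ o
m≤a⇒o≤1⇒a≰[m-ε]*o {m} {a} {zero} ε _ 1≤m m≤a _ a≤0 =
  ℚ.<-irrefl refl (ℚ.<-≤-trans 0<a (subst (ℕ→ℚ a ≤ℚ_) (ℚ.*-zeroʳ (ℕ→ℚ m - ε)) a≤0))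
  where
  0<a : ℕ→ℚ 0 <ℚ ℕ→ℚ a
  0<a = ℚ.<-≤-trans (*<* (ℤ.+<+ (s≤s z≤n))) (ℕ→ℚ-mono-≤ (≤-trans 1≤m m≤a))
m≤a⇒o≤1⇒a≰[m-ε]*o {m} {a} {suc zero} ε pos _ m≤a _ a≤m-ε =
  ℚ.<-irrefl refl (ℚ.≤-<-trans (ℚ.≤-trans (ℕ→ℚ-mono-≤ m≤a) a≤m-ε′) m-ε<m)
  where
  a≤m-ε′ : ℕ→ℚ a ≤ℚ ℕ→ℚ m - ε
  a≤m-ε′ = subst (ℕ→ℚ a ≤ℚ_) (ℚ.*-identityʳ (ℕ→ℚ m - ε)) a≤m-ε
  m-ε<m : ℕ→ℚ m - ε <ℚ ℕ→ℚ m
  m-ε<m = subst (ℕ→ℚ m - ε <ℚ_) (ℚ.+-identityʳ (ℕ→ℚ m))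
            (ℚ.+-monoʳ-< (ℕ→ℚ m) (ℚ.neg-antimono-< (ℚ.positive⁻¹ ε {{pos}})))
m≤a⇒o≤1⇒a≰[m-ε]*o {o = suc (suc _)} _ _ _ _ (s≤s ())

Joins : Set
Joins = ℕ → ℕ → Bool

-- Node i founds edge i, and node k lies in edge i iff k = i or J k i.
member : Joins → ℕ → ℕ → Bool
member J i k = (i ≡ᵇ k) ∨ J k i

edgeOf : (n : ℕ) → Joins → ℕ → Edge n
edgeOf n J i = tabulate (λ k → member J i (toℕ k))

hypergraphOf : (n : ℕ) → Joins → Hypergraph n
hypergraphOf n J = L.tabulate (λ (i : Fin n) → edgeOf n J (toℕ i))

JoinsEarlier : Joins → Set
JoinsEarlier J = ∀ k i → J k i ≡ true → i < k

Cut : Joins → ℕ → ℕ → Set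
Cut J u c = ∀ k i → c ≤ k → k < u → J k i ≡ true → c ≤ i

Separated : Joins → ℕ → ℕ → ℕ → Set
Separated J u i i′ = Σ ℕ λ c → Cut J u c × does (i <? c) ≢ does (i′ <? c)

JoinsSeparated : Joins → Set
JoinsSeparated J = ∀ u i i′ → J u i ≡ true → J u i′ ≡ true → i ≢ i′ → Separated J u i i′

Closed : Joins → ℕ → Set
Closed J c = ∀ k i → c ≤ k → J k i ≡ true → c ≤ i

Cut-cong : ∀ {J J′ u c} → (∀ k i → k < u → J′ k i ≡ J k i) → Cut J u c → Cut J′ u c
Cut-cong agree cut k i c≤k k<u k→i = cut k i c≤k k<u (trans (sym (agree k i k<u)) k→i)

Separated-cong : ∀ {J J′ u i i′} → (∀ k i → k < u → J′ k i ≡ J k i) →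
  Separated J u i i′ → Separated J′ u i i′
Separated-cong agree (c , cut , differ) = c , Cut-cong agree cut , differ

Separated-sym : ∀ {J u i i′} → Separated J u i i′ → Separated J u i′ i
Separated-sym (c , cut , differ) = c , cut , λ eq → differ (sym eq)

≡ᵇ-refl : ∀ n → (n ≡ᵇ n) ≡ true
≡ᵇ-refl zero    = refl
≡ᵇ-refl (suc n) = ≡ᵇ-refl n

≢⇒≡ᵇ≡false : ∀ {a b} → a ≢ b → (a ≡ᵇ b) ≡ false
≢⇒≡ᵇ≡false {a} {b} a≢b = dec-false (a ≟ b) a≢b

false≢true : false ≢ true
false≢true ()

member-self : ∀ J i → member J i i ≡ true
member-self J i rewrite ≡ᵇ-refl i = refl

member⇒joins : ∀ J {i k} → i ≢ k → member J i k ≡ true → J k i ≡ true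
member⇒joins J i≢k i∋k rewrite ≢⇒≡ᵇ≡false i≢k = i∋k

module _ {J : Joins} (earlier : JoinsEarlier J) where

  member⇒≤ : ∀ {i k} → member J i k ≡ true → i ≤ k
  member⇒≤ {i} {k} i∋k with i ≟ k
  ... | yes refl = ≤-refl
  ... | no i≢k   = <⇒≤ (earlier k i (member⇒joins J i≢k i∋k))

  member-below : ∀ {i k} → k < i → member J i k ≡ false
  member-below {i} {k} k<i with member J i k in i∋k
  ... | false = refl
  ... | true  = ⊥-elim (<⇒≱ k<i (member⇒≤ i∋k))

  side-of-member : ∀ {u c e y} → Cut J u c → y < u → member J e y ≡ true →
    does (y <? c) ≡ does (e <? c)
  side-of-member {c = c} {e} {y} cut y<u e∋y with y <? c | e ≟ y
  ... | yes y<c | _        = trans (dec-true (y <? c) y<c)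
                                   (sym (dec-true (e <? c) (≤-<-trans (member⇒≤ e∋y) y<c)))
  ... | no  y≮c | yes refl = refl
  ... | no  y≮c | no e≢y   =
    trans (dec-false (y <? c) y≮c)
          (sym (dec-false (e <? c) (≤⇒≯ (cut y e (≮⇒≥ y≮c) y<u (member⇒joins J e≢y e∋y)))))

record Cycle (J : Joins) : Set where
  field
    last             : ℕ
    1≤last           : 1 ≤ last
    vertex edge      : ℕ → ℕ
    enters           : ∀ s → s ≤ last → member J (edge s) (vertex s) ≡ true
    leaves           : ∀ s → s ≤ last → member J (edge s) (vertex (suc s)) ≡ true
    closed           : vertex (suc last) ≡ vertex 0
    vertex-injective : ∀ {s s′} → s ≤ last → s′ ≤ last → vertex s ≡ vertex s′ → s ≡ s′
    edge-injective   : ∀ {s s′} → s ≤ last → s′ ≤ last → edge s ≡ edge s′ → s ≡ s′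

argmax : (f : ℕ → ℕ) (n : ℕ) → Σ ℕ λ t → t ≤ n × (∀ s → s ≤ n → f s ≤ f t)
argmax f zero = 0 , z≤n , λ { zero _ → ≤-refl }
argmax f (suc n) with argmax f n
... | t , t≤n , f≤ft with f (suc n) ≤? f t
...   | yes fn≤ft = t , m≤n⇒m≤1+n t≤n , bound
  where
  bound : ∀ s → s ≤ suc n → f s ≤ f t
  bound s s≤1+n with m≤n⇒m<n∨m≡n s≤1+n
  ... | inj₁ s<1+n = f≤ft s (≤-pred s<1+n)
  ... | inj₂ refl  = fn≤ft
...   | no  fn≰ft = suc n , ≤-refl , bound
  where
  bound : ∀ s → s ≤ suc n → f s ≤ f (suc n)
  bound s s≤1+n with m≤n⇒m<n∨m≡n s≤1+n
  ... | inj₁ s<1+n = ≤-trans (f≤ft s (≤-pred s<1+n)) (<⇒≤ (≰⇒> fn≰ft))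
  ... | inj₂ refl  = ≤-refl

chain : ∀ {A : Set} (f : ℕ → A) {a b} → a ≤ b → (∀ s → a ≤ s → s < b → f s ≡ f (suc s)) → f a ≡ f b
chain f {b = zero}  z≤n  _    = refl
chain f {a} {suc b} a≤1+b step with m≤n⇒m<n∨m≡n a≤1+b
... | inj₂ refl  = refl
... | inj₁ a<1+b = trans (chain f (≤-pred a<1+b) (λ s a≤s s<b → step s a≤s (m<n⇒m<1+n s<b)))
                         (step b (≤-pred a<1+b) ≤-refl)

module _ {J : Joins} (earlier : JoinsEarlier J) (separated : JoinsSeparated J) (C : Cycle J) where
  open Cycle C

  private
    peak   = argmax vertex last
    t      = proj₁ peak
    t≤last = proj₁ (proj₂ peak)
    v      = vertex t

    below-peak : ∀ {s} → s ≤ last → s ≢ t → vertex s < v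
    below-peak s≤last s≢t =
      ≤∧≢⇒< (proj₂ (proj₂ peak) _ s≤last) (λ eq → s≢t (vertex-injective s≤last t≤last eq))

    edge-below-peak : ∀ s → s ≤ last → edge s < v
    edge-below-peak s s≤last with s ≟ t
    ... | no s≢t = ≤-<-trans (member⇒≤ earlier (enters s s≤last)) (below-peak s≤last s≢t)
    ... | yes refl with suc s ≤? last
    ...   | yes s<last = ≤-<-trans (member⇒≤ earlier (leaves s s≤last))
                                   (below-peak s<last (λ eq → <⇒≢ (n<1+n _) (sym eq)))
    ...   | no  s≮last = ≤-<-trans (member⇒≤ earlier (subst (λ w → member J (edge s) w ≡ true) closed′ (leaves s s≤last)))
                                   (below-peak z≤n 0≢s)
      where
      s≡last = ≤-antisym s≤last (≮⇒≥ s≮last)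
      closed′ : vertex (suc s) ≡ vertex 0
      closed′ = trans (cong (vertex ∘ suc) s≡last) closed
      0≢s : 0 ≢ s
      0≢s 0≡s = <⇒≱ 1≤last (≤-reflexive (trans (sym s≡last) (sym 0≡s)))

    joins-peak : ∀ {s} → s ≤ last → member J (edge s) v ≡ true → J v (edge s) ≡ true
    joins-peak s≤last = member⇒joins J (<⇒≢ (edge-below-peak _ s≤last))

    module Sides {c} (cut : Cut J v c) where
      side : ℕ → Bool
      side s = does (edge s <? c)

      junction : ∀ s → suc s ≤ last → suc s ≢ t → side s ≡ side (suc s)
      junction s s<last s+1≢t =
        trans (sym (side-of-member earlier cut w<v (leaves s (<⇒≤ s<last))))
              (side-of-member earlier cut w<v (enters (suc s) s<last))
        where w<v = below-peak s<last s+1≢t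

      wrap : 0 ≢ t → side last ≡ side 0
      wrap 0≢t =
        trans (sym (side-of-member earlier cut w<v
                     (subst (λ w → member J (edge last) w ≡ true) closed (leaves last ≤-refl))))
              (side-of-member earlier cut w<v (enters 0 z≤n))
        where w<v = below-peak z≤n 0≢t

    CyclicPredecessor : ℕ → ℕ → Set
    CyclicPredecessor p t = suc p ≡ t ⊎ (p ≡ last × t ≡ 0)

    cyclic-predecessor : ∀ t → Σ ℕ λ p → CyclicPredecessor p t
    cyclic-predecessor zero    = last , inj₂ (refl , refl)
    cyclic-predecessor (suc p) = p , inj₁ refl

    predecessor-side : ∀ {p c} (cut : Cut J v c) → CyclicPredecessor p t → Sides.side cut p ≡ Sides.side cut t
    predecessor-side {p} cut (inj₁ 1+p≡t) =
      sym (trans (chain side t≤last (λ s t≤s s<last → junction s s<last (λ eq → <⇒≢ (s≤s t≤s) (sym eq))))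
                 (trans (wrap (λ 0≡t → 0≢1+n (trans 0≡t (sym 1+p≡t))))
                        (chain side z≤n (λ s _ s<p → junction s (≤-trans s<p p≤last)
                                                               (λ eq → <⇒≢ (s≤s s<p) (trans eq (sym 1+p≡t)))))))
      where
      open Sides cut
      p≤last : p ≤ last
      p≤last = <⇒≤ (subst (_≤ last) (sym 1+p≡t) t≤last)
    predecessor-side {p} cut (inj₂ (p≡last , t≡0)) =
      trans (cong side p≡last)
            (sym (trans (cong side t≡0)
                        (chain side z≤n (λ s _ s<last → junction s s<last (λ eq → 0≢1+n (trans (sym t≡0) (sym eq)))))))
      where open Sides cut

    predecessor-facts : ∀ {p} → CyclicPredecessor p t → p ≤ last × p ≢ t × member J (edge p) v ≡ true
    predecessor-facts {p} (inj₁ 1+p≡t) =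
      p≤last , (λ p≡t → <⇒≢ (≤-reflexive 1+p≡t) p≡t) ,
      subst (λ w → member J (edge p) w ≡ true) (cong vertex 1+p≡t) (leaves p p≤last)
      where
      p≤last : p ≤ last
      p≤last = <⇒≤ (subst (_≤ last) (sym 1+p≡t) t≤last)
    predecessor-facts (inj₂ (refl , t≡0)) =
      ≤-refl , (λ last≡t → <⇒≱ 1≤last (≤-reflexive (trans last≡t t≡0))) ,
      subst (λ w → member J (edge last) w ≡ true) (trans closed (cong vertex (sym t≡0))) (leaves last ≤-refl)

  -- The two cycle edges through the highest vertex v are separated at v, yet the rest of
  -- the cycle links them through vertices below v, where no cut can be crossed.
  acyclic : ⊥
  acyclic with cyclic-predecessor t
  ... | p , pred with predecessor-facts pred
  ... | p≤last , p≢t , p∋v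
    with separated v (edge p) (edge t) (joins-peak p≤last p∋v) (joins-peak t≤last (enters t t≤last))
                   (λ eq → p≢t (edge-injective p≤last t≤last eq))
  ... | c , cut , sides-differ = sides-differ (predecessor-side cut pred)

lookup-tabulate-toℕ : ∀ {A : Set} n (g : ℕ → A) (j : Fin (length (L.tabulate {n = n} (g ∘ toℕ)))) →
  L.lookup (L.tabulate {n = n} (g ∘ toℕ)) j ≡ g (toℕ j)
lookup-tabulate-toℕ (suc n) g fzero    = refl
lookup-tabulate-toℕ (suc n) g (fsuc j) = lookup-tabulate-toℕ n (g ∘ suc) j

∈ₑ-hypergraphOf : ∀ {n J} (j : Fin (length (hypergraphOf n J))) (k : Fin n) →
  k ∈ₑ L.lookup (hypergraphOf n J) j → member J (toℕ j) (toℕ k) ≡ true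
∈ₑ-hypergraphOf {n} {J} j k k∈j =
  trans (sym (trans (cong (λ e → lookup e k) (lookup-tabulate-toℕ n (edgeOf n J) j)) (lookup∘tabulate _ k))) k∈j

toℕ-mod : ∀ {s k} → s < suc k → toℕ (s mod suc k) ≡ s
toℕ-mod {s} {k} s<1+k = trans (toℕ-fromℕ< _) (m<n⇒m%n≡m s<1+k)

mod-inject₁ : ∀ {s k} → s < suc k → inject₁ (s mod suc k) ≡ s mod suc (suc k)
mod-inject₁ s<1+k = toℕ-injective (trans (toℕ-inject₁ _) (trans (toℕ-mod s<1+k) (sym (toℕ-mod (m<n⇒m<1+n s<1+k)))))

mod-suc : ∀ {s k} → s < suc k → fsuc (s mod suc k) ≡ suc s mod suc (suc k)
mod-suc s<1+k = toℕ-injective (trans (cong suc (toℕ-mod s<1+k)) (sym (toℕ-mod (s≤s s<1+k))))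

fromℕ-mod : ∀ k → fromℕ k ≡ k mod suc k
fromℕ-mod k = toℕ-injective (trans (toℕ-fromℕ k) (sym (toℕ-mod ≤-refl)))

hypercycle⇒cycle : ∀ {n J} → Hypercycle (hypergraphOf n J) → Cycle J
hypercycle⇒cycle {n} {J} record { ℓ = suc last ; ℓ≥2 = s≤s 1≤last ; vs = vs ; es = es ; closed = closed
                                ; vs-inj = vs-inj ; es-inj = es-inj ; left = left ; right = right } = record
  { last             = last
  ; 1≤last           = 1≤last
  ; vertex           = vertex
  ; edge             = edge
  ; enters           = λ s s≤last → ∈ₑ-hypergraphOf {n} {J} (es (s mod suc last)) _
      (subst (λ x → vs x ∈ₑ L.lookup E (es (s mod suc last))) (mod-inject₁ (s≤s s≤last)) (left (s mod suc last)))
  ; leaves           = λ s s≤last → ∈ₑ-hypergraphOf {n} {J} (es (s mod suc last)) _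
      (subst (λ x → vs x ∈ₑ L.lookup E (es (s mod suc last))) (mod-suc (s≤s s≤last)) (right (s mod suc last)))
  ; closed           = cong toℕ (trans (cong vs (sym (fromℕ-mod (suc last)))) closed)
  ; vertex-injective = λ s≤last s′≤last eq → mod-injective s≤last s′≤last
      (vs-inj (trans (cong vs (mod-inject₁ (s≤s s≤last)))
              (trans (toℕ-injective eq) (cong vs (sym (mod-inject₁ (s≤s s′≤last)))))))
  ; edge-injective   = λ s≤last s′≤last eq → mod-injective s≤last s′≤last (es-inj (toℕ-injective eq))
  }
  where
  E = hypergraphOf n J
  vertex edge : ℕ → ℕ
  vertex s = toℕ (vs (s mod suc (suc last)))
  edge   s = toℕ (es (s mod suc last))
  mod-injective : ∀ {s s′} → s ≤ last → s′ ≤ last → s mod suc last ≡ s′ mod suc last → s ≡ s′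
  mod-injective s≤last s′≤last eq =
    trans (sym (toℕ-mod (s≤s s≤last))) (trans (cong toℕ eq) (toℕ-mod (s≤s s′≤last)))

hypergraphOf-isHyperforest : ∀ {n J} → JoinsEarlier J → JoinsSeparated J → IsHyperforest (hypergraphOf n J)
hypergraphOf-isHyperforest earlier separated hc = acyclic earlier separated (hypercycle⇒cycle hc)

Causal : ∀ {m} → (ℕ → Joins → Fin m) → Set
Causal O = ∀ k J J′ → (∀ k′ i → k′ ≤ k → J k′ i ≡ J′ k′ i) → O k J ≡ O k J′

colored : ∀ {m} → (ℕ → Fin m) → Fin m → ℕ → Bool
colored col y k = does (col k F.≟ y)

lookup≤sum : ∀ {n} (v : Vec ℕ n) c → lookup v c ≤ sum v
lookup≤sum (a ∷ v) fzero    = m≤m+n a (sum v)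
lookup≤sum (a ∷ v) (fsuc c) = ≤-trans (lookup≤sum v c) (m≤n+m (sum v) a)

sum-update : ∀ {n} (v : Vec ℕ n) c {k} → lookup v c ≡ suc k → sum v ≡ suc (sum (v [ c ]≔ k))
sum-update (a ∷ v) fzero    refl = refl
sum-update (a ∷ v) (fsuc c) vc≡1+k = trans (cong (a +_) (sum-update v c vc≡1+k)) (+-suc a _)

sum-replicate : ∀ n a → sum (replicate n a) ≡ n * a
sum-replicate zero    a = refl
sum-replicate (suc n) a = cong (a +_) (sum-replicate n a)

budget : ℕ → ℕ → ℕ
budget m zero    = 1
budget m (suc f) = suc (m * budget m f)

-- O k J is the algorithm's color for node k.
module Adversary (m′ : ℕ) (O : ℕ → Joins → Fin (suc m′)) (causal : Causal O) where

  m : ℕ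
  m = suc m′

  record State : Set where
    field
      nodes : ℕ
      joins : Joins
      color : ℕ → Fin m   -- the offline coloring, which will witness OPT ≤ 1
  open State public

  record Valid (s : State) : Set where
    field
      earlier   : JoinsEarlier (joins s)
      quiet     : ∀ k i → nodes s ≤ k → joins s k i ≡ false
      separated : JoinsSeparated (joins s)
      small     : ∀ i → count (member (joins s) i) (nodes s) ≤ m
      rainbow   : ∀ i y → count (λ k → member (joins s) i k ∧ colored (color s) y k) (nodes s) ≤ 1

  record _⊑_ (s s′ : State) : Set where
    field
      grows      : nodes s ≤ nodes s′
      joins-kept : ∀ k i → k < nodes s → joins s′ k i ≡ joins s k i
      color-kept : ∀ k → k < nodes s → color s′ k ≡ color s k
      fresh      : Closed (joins s′) (nodes s)
  open _⊑_ public

  quiet⇒closed : ∀ {s} → Valid s → Closed (joins s) (nodes s)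
  quiet⇒closed {s} valid k i n≤k k→i = ⊥-elim (false≢true (trans (sym (Valid.quiet valid k i n≤k)) k→i))

  ⊑-refl : ∀ {s} → Valid s → s ⊑ s
  ⊑-refl valid = record { grows = ≤-refl ; joins-kept = λ _ _ _ → refl ; color-kept = λ _ _ → refl
                        ; fresh = quiet⇒closed valid }

  ⊑-trans : ∀ {s₁ s₂ s₃} → s₁ ⊑ s₂ → s₂ ⊑ s₃ → s₁ ⊑ s₃
  ⊑-trans {s₁} {s₂} {s₃} ext₁₂ ext₂₃ = record
    { grows      = ≤-trans (grows ext₁₂) (grows ext₂₃)
    ; joins-kept = λ k i k< → trans (joins-kept ext₂₃ k i (<-≤-trans k< (grows ext₁₂))) (joins-kept ext₁₂ k i k<)
    ; color-kept = λ k k< → trans (color-kept ext₂₃ k (<-≤-trans k< (grows ext₁₂))) (color-kept ext₁₂ k k<)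
    ; fresh      = fresh₁₃ }
    where
    fresh₁₃ : Closed (joins s₃) (nodes s₁)
    fresh₁₃ k i n₁≤k k→i with k <? nodes s₂
    ... | yes k<n₂ = fresh ext₁₂ k i n₁≤k (trans (sym (joins-kept ext₂₃ k i k<n₂)) k→i)
    ... | no  k≮n₂ = ≤-trans (grows ext₁₂) (fresh ext₂₃ k i (≮⇒≥ k≮n₂) k→i)

  module _ {s s′ : State} (ext : s ⊑ s′) where

    member-⊑ : ∀ {e k} → e < nodes s → member (joins s′) e k ≡ true → k < nodes s × member (joins s) e k ≡ true
    member-⊑ {e} {k} e<n e∋k with k <? nodes s
    ... | yes k<n = k<n , trans (cong ((e ≡ᵇ k) ∨_) (sym (joins-kept ext k e k<n))) e∋k
    ... | no  k≮n = ⊥-elim (<⇒≱ e<n (fresh ext k e (≮⇒≥ k≮n) (member⇒joins (joins s′) e≢k e∋k)))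
      where
      e≢k : e ≢ k
      e≢k refl = k≮n e<n

    count-member-⊑ : ∀ {e} → e < nodes s → count (member (joins s′) e) (nodes s′) ≡ count (member (joins s) e) (nodes s)
    count-member-⊑ {e} e<n =
      trans (count-stable (grows ext) none-new)
            (count-cong (nodes s) (λ k k<n → cong ((e ≡ᵇ k) ∨_) (joins-kept ext k e k<n)))
      where
      none-new : ∀ k → nodes s ≤ k → k < nodes s′ → member (joins s′) e k ≡ false
      none-new k n≤k _ with member (joins s′) e k in e∋k
      ... | false = refl
      ... | true  = ⊥-elim (<⇒≱ (proj₁ (member-⊑ e<n e∋k)) n≤k)

    online-⊑ : ∀ {k} → k < nodes s → O k (joins s′) ≡ O k (joins s)
    online-⊑ k<n = causal _ _ _ (λ k′ i k′≤k → joins-kept ext k′ i (≤-<-trans k′≤k k<n))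

  record Token (s : State) (e : ℕ) (x : Fin m) (size lo : ℕ) : Set where
    field
      edge<   : e < nodes s
      size≡   : count (member (joins s) e) (nodes s) ≡ size
      online  : ∀ {k} → k < nodes s → member (joins s) e k ≡ true → O k (joins s) ≡ x
      offline : ∀ {k} → k < nodes s → member (joins s) e k ≡ true → lo ≤ toℕ (color s k)

  Token-⊑ : ∀ {s s′ e x size lo} → s ⊑ s′ → Token s e x size lo → Token s′ e x size lo
  Token-⊑ {s} {s′} ext token = record
    { edge<   = <-≤-trans edge< (grows ext)
    ; size≡   = trans (count-member-⊑ ext edge<) size≡
    ; online  = λ _ e∋k → let k<n , e∋k′ = member-⊑ ext edge< e∋k in
                trans (online-⊑ ext k<n) (online k<n e∋k′)
    ; offline = λ _ e∋k → let k<n , e∋k′ = member-⊑ ext edge< e∋k in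
                subst (λ y → _ ≤ toℕ y) (sym (color-kept ext _ k<n)) (offline k<n e∋k′)
    }
    where open Token token

  attach : State → (ℕ → Bool) → Fin m → State
  attach s targets y = record
    { nodes = suc (nodes s)
    ; joins = λ k → if k ≡ᵇ nodes s then targets else joins s k
    ; color = λ k → if k ≡ᵇ nodes s then y else color s k
    }

  module Attach (s : State) (valid : Valid s) (targets : ℕ → Bool) (y : Fin m) where
    private
      u  = nodes s
      J  = joins s
      s′ = attach s targets y
      J′ = joins s′
      module V = Valid valid

    joins-new : ∀ i → J′ u i ≡ targets i
    joins-new i rewrite ≡ᵇ-refl u = refl

    joins-old : ∀ k i → k ≢ u → J′ k i ≡ J k i
    joins-old k i k≢u rewrite ≢⇒≡ᵇ≡false k≢u = refl

    joins-below : ∀ k i → k < u → J′ k i ≡ J k i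
    joins-below k i k<u = joins-old k i (<⇒≢ k<u)

    color-new : color s′ u ≡ y
    color-new rewrite ≡ᵇ-refl u = refl

    color-below : ∀ k → k < u → color s′ k ≡ color s k
    color-below k k<u rewrite ≢⇒≡ᵇ≡false (<⇒≢ k<u) = refl

    member-below-u : ∀ i k → k < u → member J′ i k ≡ member J i k
    member-below-u i k k<u = cong ((i ≡ᵇ k) ∨_) (joins-below k i k<u)

    member-new : ∀ i → member J′ i u ≡ (i ≡ᵇ u) ∨ targets i
    member-new i = cong ((i ≡ᵇ u) ∨_) (joins-new i)

    online-below : ∀ k → k < u → O k J′ ≡ O k J
    online-below k k<u = causal _ _ _ (λ k′ i k′≤k → joins-below k′ i (≤-<-trans k′≤k k<u))

    member-new-≢ : ∀ {i} → i ≢ u → member J′ i u ≡ targets i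
    member-new-≢ {i} i≢u = trans (member-new i) (cong (_∨ targets i) (≢⇒≡ᵇ≡false i≢u))

    own-edge-empty-below : ∀ (q : ℕ → Bool) → count (λ k → member J u k ∧ q k) u ≡ 0
    own-edge-empty-below q = count-none u (λ k k<u → cong (_∧ q k) (member-below V.earlier k<u))

    count-member-old : ∀ i → count (member J′ i) (suc u) ≡ count (member J i) u + indicator (member J′ i u)
    count-member-old i = cong (_+ indicator (member J′ i u)) (count-cong u (λ k k<u → member-below-u i k k<u))

    count-colored-old : ∀ i y′ → count (λ k → member J′ i k ∧ colored (color s′) y′ k) (suc u) ≡
      count (λ k → member J i k ∧ colored (color s) y′ k) u + indicator (member J′ i u ∧ colored (color s′) y′ u)
    count-colored-old i y′ = cong (_+ indicator (member J′ i u ∧ colored (color s′) y′ u)) (count-cong u (λ k k<u →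
      cong₂ (λ a c → a ∧ does (c F.≟ y′)) (member-below-u i k k<u) (color-below k k<u)))

    own-size : count (member J′ u) (suc u) ≡ 1
    own-size = trans (count-member-old u)
      (cong₂ _+_ (trans (count-cong u (λ k _ → sym (∧-identityʳ _))) (own-edge-empty-below (λ _ → true)))
                 (cong indicator (member-self J′ u)))

    module _ (targets-old       : ∀ i → targets i ≡ true → i < u)
             (targets-separated : ∀ i i′ → targets i ≡ true → targets i′ ≡ true → i ≢ i′ → Separated J u i i′)
             (targets-roomy     : ∀ i → targets i ≡ true → count (member J i) u < m)
             (targets-avoid-y   : ∀ i → targets i ≡ true → ∀ k → k < u → member J i k ≡ true → color s k ≢ y)
             where

      private
        earlier′ : JoinsEarlier J′
        earlier′ k i k→i with k ≟ u
        ... | yes refl = targets-old i (trans (sym (joins-new i)) k→i)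
        ... | no  k≢u  = V.earlier k i (trans (sym (joins-old k i k≢u)) k→i)

        quiet′ : ∀ k i → suc u ≤ k → J′ k i ≡ false
        quiet′ k i u<k = trans (joins-old k i (>⇒≢ u<k)) (V.quiet k i (<⇒≤ u<k))

        separated′ : JoinsSeparated J′
        separated′ w i i′ w→i w→i′ i≢i′ with <-cmp w u
        ... | tri< w<u _ _ = Separated-cong (λ k j k<w → joins-below k j (<-trans k<w w<u))
            (V.separated w i i′ (trans (sym (joins-below w i w<u)) w→i) (trans (sym (joins-below w i′ w<u)) w→i′) i≢i′)
        ... | tri≈ _ refl _ = Separated-cong joins-below
            (targets-separated i i′ (trans (sym (joins-new i)) w→i) (trans (sym (joins-new i′)) w→i′) i≢i′)
        ... | tri> _ _ u<w = ⊥-elim (false≢true (trans (sym (quiet′ w i u<w)) w→i))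

        small′ : ∀ i → count (member J′ i) (suc u) ≤ m
        small′ i with i ≟ u
        ... | yes refl = ≤-trans (≤-reflexive own-size) (s≤s z≤n)
        ... | no  i≢u rewrite count-member-old i | member-new-≢ i≢u with targets i in targeted
        ...   | true  = subst (_≤ m) (+-comm 1 _) (targets-roomy i targeted)
        ...   | false = subst (_≤ m) (sym (+-identityʳ _)) (V.small i)

        rainbow′ : ∀ i y′ → count (λ k → member J′ i k ∧ colored (color s′) y′ k) (suc u) ≤ 1
        rainbow′ i y′ rewrite count-colored-old i y′ with i ≟ u
        ... | yes refl rewrite own-edge-empty-below (colored (color s) y′) = indicator≤1 _
        ... | no  i≢u rewrite member-new-≢ i≢u with targets i in targeted | y F.≟ y′
        ...   | false | _        = subst (_≤ 1) (sym (+-identityʳ _)) (V.rainbow i y′)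
        ...   | true  | yes refl = subst (λ a → a + indicator _ ≤ 1) (sym (count-none u none-y)) (indicator≤1 _)
          where
          none-y : ∀ k → k < u → (member J i k ∧ colored (color s) y k) ≡ false
          none-y k k<u with member J i k in i∋k
          ... | false = refl
          ... | true  = dec-false (color s k F.≟ y) (targets-avoid-y i targeted k k<u i∋k)
        ...   | true  | no  y≢y′ rewrite color-new | dec-false (y F.≟ y′) y≢y′ =
                subst (_≤ 1) (sym (+-identityʳ _)) (V.rainbow i y′)

      attach-valid : Valid s′
      attach-valid = record { earlier = earlier′ ; quiet = quiet′ ; separated = separated′
                            ; small = small′ ; rainbow = rainbow′ }

    ⊑-attach : ∀ {s₀} → s₀ ⊑ s → (∀ i → targets i ≡ true → nodes s₀ ≤ i) → s₀ ⊑ s′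
    ⊑-attach {s₀} ext targets-new = record
      { grows      = m≤n⇒m≤1+n (grows ext)
      ; joins-kept = λ k i k< → trans (joins-below k i (<-≤-trans k< (grows ext))) (joins-kept ext k i k<)
      ; color-kept = λ k k< → trans (color-below k (<-≤-trans k< (grows ext))) (color-kept ext k k<)
      ; fresh      = fresh′ }
      where
      fresh′ : Closed J′ (nodes s₀)
      fresh′ k i n₀≤k k→i with k ≟ u
      ... | yes refl = targets-new i (trans (sym (joins-new i)) k→i)
      ... | no  k≢u  = fresh ext k i n₀≤k (trans (sym (joins-old k i k≢u)) k→i)

    token-grows : ∀ {e x size lo} → targets e ≡ true → Token s e x size lo → O u J′ ≡ x → lo ≤ toℕ y →
      Token s′ e x (suc size) lo
    token-grows {e} {x} {size} {lo} targeted token u↦x lo≤y = record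
      { edge<   = m<n⇒m<1+n edge<
      ; size≡   = trans (count-member-old e)
                    (trans (cong₂ _+_ size≡ (cong indicator (trans (member-new e)
                                                  (trans (cong ((e ≡ᵇ u) ∨_) targeted) (∨-zeroʳ _)))))
                           (+-comm size 1))
      ; online  = online′
      ; offline = offline′ }
      where
      open Token token
      online′ : ∀ {k} → k < suc u → member J′ e k ≡ true → O k J′ ≡ x
      online′ {k} k≤u e∋k with k ≟ u
      ... | yes refl = u↦x
      ... | no  k≢u  = let k<u = ≤∧≢⇒< (≤-pred k≤u) k≢u in
                       trans (online-below k k<u) (online k<u (trans (sym (member-below-u e k k<u)) e∋k))
      offline′ : ∀ {k} → k < suc u → member J′ e k ≡ true → lo ≤ toℕ (color s′ k)
      offline′ {k} k≤u e∋k with k ≟ u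
      ... | yes refl = subst (λ c → lo ≤ toℕ c) (sym color-new) lo≤y
      ... | no  k≢u  = let k<u = ≤∧≢⇒< (≤-pred k≤u) k≢u in
                       subst (λ c → lo ≤ toℕ c) (sym (color-below k k<u))
                             (offline k<u (trans (sym (member-below-u e k k<u)) e∋k))

    token-fresh : ∀ {lo} → lo ≤ toℕ y → Token s′ u (O u J′) 1 lo
    token-fresh {lo} lo≤y = record
      { edge<   = ≤-refl
      ; size≡   = own-size
      ; online  = λ k≤u u∋k → cong (λ k → O k J′) (own-only k≤u u∋k)
      ; offline = λ k≤u u∋k → subst (λ k → lo ≤ toℕ (color s′ k)) (sym (own-only k≤u u∋k))
                                    (subst (λ c → lo ≤ toℕ c) (sym color-new) lo≤y) }
      where
      own-only : ∀ {k} → k < suc u → member J′ u k ≡ true → k ≡ u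
      own-only {k} k≤u u∋k with k ≟ u
      ... | yes k≡u = k≡u
      ... | no  k≢u = let k<u = ≤∧≢⇒< (≤-pred k≤u) k≢u in
                      ⊥-elim (false≢true (trans (sym (member-below V.earlier k<u))
                                                (trans (sym (member-below-u u k k<u)) u∋k)))

  recolor : State → ℕ → Permutation′ m → State
  recolor s r π = record s { color = λ k → if does (r ≤? k) then π ⟨$⟩ʳ color s k else color s k }

  colored-permute : ∀ (π : Permutation′ m) a y → does (π ⟨$⟩ʳ a F.≟ y) ≡ does (a F.≟ π ⟨$⟩ˡ y)
  colored-permute π a y with a F.≟ π ⟨$⟩ˡ y
  ... | yes refl = dec-true (π ⟨$⟩ʳ (π ⟨$⟩ˡ y) F.≟ y) (inverseʳ π)
  ... | no  a≢y  = dec-false (π ⟨$⟩ʳ a F.≟ y) (λ eq → a≢y (trans (sym (inverseˡ π)) (cong (π ⟨$⟩ˡ_) eq)))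

  module Recolor (s : State) (r : ℕ) (π : Permutation′ m) where
    private
      s′ = recolor s r π

    color-inside : ∀ {k} → r ≤ k → color s′ k ≡ π ⟨$⟩ʳ color s k
    color-inside {k} r≤k rewrite dec-true (r ≤? k) r≤k = refl

    color-outside : ∀ {k} → k < r → color s′ k ≡ color s k
    color-outside {k} k<r rewrite dec-false (r ≤? k) (<⇒≱ k<r) = refl

    recolor-valid : Valid s → Closed (joins s) r → Valid s′
    recolor-valid valid sealed = record
      { earlier = earlier ; quiet = quiet ; separated = separated ; small = small ; rainbow = rainbow′ }
      where
      open Valid valid
      rainbow′ : ∀ i y → count (λ k → member (joins s) i k ∧ colored (color s′) y k) (nodes s) ≤ 1
      rainbow′ i y with r ≤? i
      ... | yes r≤i = subst (_≤ 1) (count-cong (nodes s) inside) (rainbow i (π ⟨$⟩ˡ y))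
        where
        inside : ∀ k → k < nodes s → (member (joins s) i k ∧ colored (color s) (π ⟨$⟩ˡ y) k) ≡
                                     (member (joins s) i k ∧ colored (color s′) y k)
        inside k _ with member (joins s) i k in i∋k
        ... | false = refl
        ... | true  = trans (sym (colored-permute π (color s k) y))
                            (cong (λ c → does (c F.≟ y)) (sym (color-inside (≤-trans r≤i (member⇒≤ earlier i∋k)))))
      ... | no  r≰i = subst (_≤ 1) (count-cong (nodes s) outside) (rainbow i y)
        where
        outside : ∀ k → k < nodes s → (member (joins s) i k ∧ colored (color s) y k) ≡
                                      (member (joins s) i k ∧ colored (color s′) y k)
        outside k _ with member (joins s) i k in i∋k | k <? r
        ... | false | _       = refl
        ... | true  | yes k<r = cong (λ c → does (c F.≟ y)) (sym (color-outside k<r))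
        ... | true  | no  k≮r = ⊥-elim (r≰i (sealed k i (≮⇒≥ k≮r) (member⇒joins (joins s) i≢k i∋k)))
          where
          i≢k : i ≢ k
          i≢k refl = k≮r (≰⇒> r≰i)

    ⊑-recolor : ∀ {s₀} → s₀ ⊑ s → nodes s₀ ≡ r → s₀ ⊑ s′
    ⊑-recolor ext refl = record
      { grows = grows ext ; joins-kept = joins-kept ext ; fresh = fresh ext
      ; color-kept = λ k k<r → trans (color-outside k<r) (color-kept ext k k<r) }

  top : Fin m
  top = fromℕ m′

  toℕ-top : toℕ top ≡ m′
  toℕ-top = toℕ-fromℕ m′

  transpose-top-below : ∀ {q} (q<m′ : q < m′) (z : Fin m) → q < toℕ z →
    let z′ = transpose top (fromℕ< (m<n⇒m<1+n q<m′)) ⟨$⟩ʳ z in q ≤ toℕ z′ × toℕ z′ < m′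
  transpose-top-below {q} q<m′ z q<z with z F.≟ top
  ... | yes _     rewrite toℕ-fromℕ< (m<n⇒m<1+n q<m′) = ≤-refl , q<m′
  ... | no  z≢top rewrite dec-false (z F.≟ fromℕ< (m<n⇒m<1+n q<m′)) (λ { refl → <-irrefl (sym (toℕ-fromℕ< _)) q<z }) =
    <⇒≤ q<z , ≤∧≢⇒< (≤-pred (toℕ<n z)) (λ eq → z≢top (toℕ-injective (trans eq (sym toℕ-top))))

  empty : State
  empty = record { nodes = 0 ; joins = λ _ _ → false ; color = λ _ → top }

  empty-valid : Valid empty
  empty-valid = record { earlier = λ _ _ () ; quiet = λ _ _ _ → refl ; separated = λ _ _ _ () ; small = λ _ → z≤n
                       ; rainbow = λ _ _ → z≤n }

  pad : State → ℕ → State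
  pad s zero    = s
  pad s (suc d) = attach (pad s d) (λ _ → false) top

  nodes-pad : ∀ s d → nodes (pad s d) ≡ d + nodes s
  nodes-pad s zero    = refl
  nodes-pad s (suc d) = cong suc (nodes-pad s d)

  pad-valid : ∀ {s} d → Valid s → Valid (pad s d) × s ⊑ pad s d
  pad-valid zero    valid = valid , ⊑-refl valid
  pad-valid {s} (suc d) valid =
    let valid′ , ext = pad-valid d valid
        open Attach (pad s d) valid′ (λ _ → false) top
    in attach-valid (λ _ ()) (λ _ _ ()) (λ _ ()) (λ _ ()) , ⊑-attach ext (λ _ ())

  -- A monochromatic edge of color hue, built in a region of nodes that ends before bound.
  record Entry : Set where
    constructor entry
    field
      hue   : Fin m
      edge  : ℕ
      bound : ℕ
  open Entry

  record Stocked (v : Vec ℕ m) (s : State) (E : Entry) : Set where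
    field
      edge<bound : edge E < bound E
      bound≤     : bound E ≤ nodes s
      sealed     : Closed (joins s) (bound E)
      token      : Token s (edge E) (hue E) (lookup v (hue E)) (m′ ∸ lookup v (hue E))
      below-top  : ∀ {k} → k < nodes s → member (joins s) (edge E) k ≡ true → toℕ (color s k) < m′

  Stocked-⊑ : ∀ {v s s′ E} → s ⊑ s′ → Stocked v s E → Stocked v s′ E
  Stocked-⊑ {v} {s} {s′} {E} ext stocked = record
    { edge<bound = edge<bound
    ; bound≤     = ≤-trans bound≤ (grows ext)
    ; sealed     = sealed′
    ; token      = Token-⊑ ext token
    ; below-top  = λ _ e∋k → let k<n , e∋k′ = member-⊑ ext (<-≤-trans edge<bound bound≤) e∋k in
                   subst (λ c → toℕ c < m′) (sym (color-kept ext _ k<n)) (below-top k<n e∋k′)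
    }
    where
    open Stocked stocked
    sealed′ : Closed (joins s′) (bound E)
    sealed′ k i b≤k k→i with k <? nodes s
    ... | yes k<n = sealed k i b≤k (trans (sym (joins-kept ext k i k<n)) k→i)
    ... | no  k≮n = ≤-trans bound≤ (fresh ext k i (≮⇒≥ k≮n) k→i)

  Precedes : Entry → Entry → Set
  Precedes E E′ = bound E′ ≤ edge E

  separated-by-bound : ∀ {v s E i} → Stocked v s E → bound E ≤ i → Separated (joins s) (nodes s) (edge E) i
  separated-by-bound {E = E} {i} stocked b≤i =
    bound E , (λ k j b≤k _ → Stocked.sealed stocked k j b≤k) ,
    λ eq → false≢true (trans (sym (dec-false (i <? bound E) (≤⇒≯ b≤i)))
                             (trans (sym eq) (dec-true (edge E <? bound E) (Stocked.edge<bound stocked))))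

  entries-separated : ∀ {v s P} → All (Stocked v s) P → AllPairs Precedes P →
    ∀ {E E′} → E ∈ P → E′ ∈ P → edge E ≢ edge E′ → Separated (joins s) (nodes s) (edge E) (edge E′)
  entries-separated _ _ (here refl) (here refl) differ = ⊥-elim (differ refl)
  entries-separated (_ ∷ stocked) (after ∷ _) (here refl) (there E′∈) _ =
    Separated-sym (separated-by-bound (All.lookup stocked E′∈) (All.lookup after E′∈))
  entries-separated (_ ∷ stocked) (after ∷ _) (there E∈) (here refl) _ =
    separated-by-bound (All.lookup stocked E∈) (All.lookup after E∈)
  entries-separated (_ ∷ stocked) (_ ∷ sorted) (there E∈) (there E′∈) differ =
    entries-separated stocked sorted E∈ E′∈ differ

  targetsOf : List Entry → ℕ → Bool
  targetsOf P i = any (λ E → edge E ≡ᵇ i) P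

  targetsOf-sound : ∀ P {i} → targetsOf P i ≡ true → Σ Entry λ E → E ∈ P × edge E ≡ i
  targetsOf-sound P {i} targeted =
    let E , E∈ , hit = find (any⁻ (λ E → edge E ≡ᵇ i) P (Equivalence.from T-≡ targeted)) in
    E , E∈ , ≡ᵇ⇒≡ (edge E) i hit

  targetsOf-complete : ∀ {P E} → E ∈ P → targetsOf P (edge E) ≡ true
  targetsOf-complete {E = E} E∈ = Equivalence.to T-≡ (any⁺ _ (lose E∈ (≡⇒≡ᵇ (edge E) (edge E) refl)))

  record Forced (s₀ : State) (v : Vec ℕ m) (b : ℕ) : Set where
    field
      state   : State
      valid   : Valid state
      extends : s₀ ⊑ state
      within  : nodes state ≤ nodes s₀ + b
      edge    : ℕ
      new     : nodes s₀ ≤ edge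
      hue     : Fin m
      token   : Token state edge hue (suc (lookup v hue)) (m′ ∸ lookup v hue)

  HasEntry : List Entry → Fin m → Set
  HasEntry P c = Any (λ E → hue E ≡ c) P

  -- Entries for the colors of v handled so far; each pending color may still cost B nodes.
  record Harvest (s₀ : State) (v : Vec ℕ m) (B : ℕ) (pending : List (Fin m)) : Set where
    field
      state   : State
      valid   : Valid state
      extends : s₀ ⊑ state
      entries : List Entry
      stocked : All (Stocked v state) entries
      sorted  : AllPairs Precedes entries
      new     : All (λ E → nodes s₀ ≤ edge E) entries
      covers  : ∀ c → lookup v c ≢ 0 → HasEntry entries c ⊎ c ∈ pending
      affordable : nodes state + length pending * B ≤ nodes s₀ + m * B

  Bounded : Vec ℕ m → Set
  Bounded v = ∀ c → lookup v c < m

  module FinalMove {s₀ v B} (v<m : Bounded v) (H : Harvest s₀ v B []) where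
    open Harvest H

    private
      u       = nodes state
      targets = targetsOf entries

    open Attach state valid targets top

    target-entry : ∀ {i} → targets i ≡ true → Σ Entry λ E → Stocked v state E × nodes s₀ ≤ edge E × edge E ≡ i
    target-entry targeted = let E , E∈ , E≡i = targetsOf-sound entries targeted in
                            E , All.lookup stocked E∈ , All.lookup new E∈ , E≡i

    targets-new : ∀ i → targets i ≡ true → nodes s₀ ≤ i
    targets-new i targeted = let _ , _ , new , E≡i = target-entry targeted in subst (nodes s₀ ≤_) E≡i new

    targets-old : ∀ i → targets i ≡ true → i < u
    targets-old i targeted = let E , ok , _ , E≡i = target-entry targeted in
      subst (_< u) E≡i (<-≤-trans (Stocked.edge<bound ok) (Stocked.bound≤ ok))

    targets-separated : ∀ i i′ → targets i ≡ true → targets i′ ≡ true → i ≢ i′ → Separated (joins state) u i i′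
    targets-separated i i′ targeted targeted′ i≢i′ =
      let E , E∈ , E≡i = targetsOf-sound entries targeted
          E′ , E′∈ , E′≡i′ = targetsOf-sound entries targeted′ in
      subst₂ (Separated (joins state) u) E≡i E′≡i′
        (entries-separated stocked sorted E∈ E′∈ (λ eq → i≢i′ (trans (sym E≡i) (trans eq E′≡i′))))

    targets-roomy : ∀ i → targets i ≡ true → count (member (joins state) i) u < m
    targets-roomy i targeted = let E , ok , _ , E≡i = target-entry targeted in
      subst (λ e → count (member (joins state) e) u < m) E≡i
        (subst (_< m) (sym (Token.size≡ (Stocked.token ok))) (v<m (hue E)))

    targets-avoid-top : ∀ i → targets i ≡ true → ∀ k → k < u → member (joins state) i k ≡ true → color state k ≢ top
    targets-avoid-top i targeted k k<u i∋k k↦top = let E , ok , _ , E≡i = target-entry targeted in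
      <-irrefl (trans (cong toℕ k↦top) toℕ-top)
        (Stocked.below-top ok k<u (subst (λ e → member (joins state) e k ≡ true) (sym E≡i) i∋k))

    next : State
    next = attach state targets top

    next-valid : Valid next
    next-valid = attach-valid targets-old targets-separated targets-roomy targets-avoid-top

    next-extends : s₀ ⊑ next
    next-extends = ⊑-attach extends targets-new

    next-within : nodes next ≤ nodes s₀ + suc (m * B)
    next-within = subst (suc u ≤_) (sym (+-suc _ _)) (s≤s (subst (_≤ _) (+-identityʳ u) affordable))

    x : Fin m
    x = O u (joins next)

    grown : Any (λ E → hue E ≡ x) entries → Forced s₀ v (suc (m * B))
    grown found = let E , E∈ , hue≡x = find found in record
      { state = next ; valid = next-valid ; extends = next-extends ; within = next-within
      ; edge = edge E ; new = All.lookup new E∈ ; hue = hue E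
      ; token = token-grows (targetsOf-complete E∈) (Stocked.token (All.lookup stocked E∈)) (sym hue≡x)
                  (subst (m′ ∸ lookup v (hue E) ≤_) (sym toℕ-top) (m∸n≤m m′ (lookup v (hue E)))) }

    unneeded : ¬ Any (λ E → hue E ≡ x) entries → lookup v x ≡ 0
    unneeded none with lookup v x ≟ 0
    ... | yes vx≡0 = vx≡0
    ... | no  vx≢0 with covers x vx≢0
    ...   | inj₁ has = ⊥-elim (none has)
    ...   | inj₂ ()

    fresh-edge : ¬ Any (λ E → hue E ≡ x) entries → Forced s₀ v (suc (m * B))
    fresh-edge none = record
      { state = next ; valid = next-valid ; extends = next-extends ; within = next-within
      ; edge = u ; new = grows extends ; hue = x
      ; token = subst (λ a → Token next u x (suc a) (m′ ∸ a)) (sym (unneeded none))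
                  (token-fresh (≤-reflexive (sym toℕ-top))) }

  final-move : ∀ {s₀ v B} → Bounded v → Harvest s₀ v B [] → Forced s₀ v (suc (m * B))
  final-move v<m H with Any.any? (λ E → hue E F.≟ FinalMove.x v<m H) (Harvest.entries H)
  ... | yes found = FinalMove.grown v<m H found
  ... | no  none  = FinalMove.fresh-edge v<m H none

  forced-rebase : ∀ {s₀ s v v′ b b′} (r : Forced s v′ b) → s₀ ⊑ s → nodes s + b ≤ nodes s₀ + b′ →
    lookup v′ (Forced.hue r) ≡ lookup v (Forced.hue r) → Forced s₀ v b′
  forced-rebase {v = v} r ext room same = record
    { state = state ; valid = valid ; extends = ⊑-trans ext extends
    ; within = ≤-trans within room ; edge = Forced.edge r ; new = ≤-trans (grows ext) new ; hue = Forced.hue r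
    ; token = subst (λ a → Token state (Forced.edge r) (Forced.hue r) (suc a) (m′ ∸ a)) same token }
    where open Forced r using (state; valid; extends; within; new; token)

  harvest-skip : ∀ {s₀ v B c pending} → lookup v c ≡ 0 → Harvest s₀ v B (c ∷ pending) → Harvest s₀ v B pending
  harvest-skip {v = v} {B} {c} {pending} vc≡0 H = record
    { state = state ; valid = valid ; extends = extends ; entries = entries ; stocked = stocked
    ; sorted = sorted ; new = new ; covers = covers′
    ; affordable = ≤-trans (+-monoʳ-≤ (nodes state) (m≤n+m (length pending * B) B)) affordable }
    where
    open Harvest H
    covers′ : ∀ c′ → lookup v c′ ≢ 0 → HasEntry entries c′ ⊎ c′ ∈ pending
    covers′ c′ vc′≢0 with covers c′ vc′≢0
    ... | inj₁ has         = inj₁ has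
    ... | inj₂ (here refl) = ⊥-elim (vc′≢0 vc≡0)
    ... | inj₂ (there c′∈) = inj₂ c′∈

  module Stock {s₀ v B c k pending} (vc≡1+k : lookup v c ≡ suc k) (v<m : Bounded v)
               (H : Harvest s₀ v B (c ∷ pending)) (r : Forced (Harvest.state H) (v [ c ]≔ k) B)
               (hue≡c : Forced.hue r ≡ c) where
    private
      s  = Harvest.state H
      s₁ = Forced.state r
      e  = Forced.edge r
      q  = m′ ∸ suc k

    1+k≤m′ : suc k ≤ m′
    1+k≤m′ = ≤-pred (subst (_< m) vc≡1+k (v<m c))

    q<m′ : q < m′
    q<m′ = ∸-monoʳ-< {m′} {suc k} {0} (s≤s z≤n) 1+k≤m′

    swapped : State
    swapped = recolor s₁ (nodes s) (transpose top (fromℕ< (m<n⇒m<1+n q<m′)))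

    open Recolor s₁ (nodes s) (transpose top (fromℕ< (m<n⇒m<1+n q<m′)))

    swapped-valid : Valid swapped
    swapped-valid = recolor-valid (Forced.valid r) (fresh (Forced.extends r))

    swapped-extends : s ⊑ swapped
    swapped-extends = ⊑-recolor (Forced.extends r) refl

    token₁ : Token s₁ e c (suc k) (m′ ∸ k)
    token₁ = subst₂ (λ x a → Token s₁ e x (suc a) (m′ ∸ a)) hue≡c
               (trans (cong (lookup (v [ c ]≔ k)) hue≡c) (lookup∘update c v k)) (Forced.token r)
    open Token token₁

    -- Swapping the top color with q moves the offline colors of the edge from [q+1, m′] to [q, m′).
    recolored : ∀ {j} → j < nodes s₁ → member (joins s₁) e j ≡ true →
      q ≤ toℕ (color swapped j) × toℕ (color swapped j) < m′
    recolored {j} j<n e∋j = subst (λ y → q ≤ toℕ y × toℕ y < m′)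
      (sym (color-inside (≤-trans (Forced.new r) (member⇒≤ (Valid.earlier (Forced.valid r)) e∋j))))
      (transpose-top-below q<m′ (color s₁ j)
        (subst (_≤ toℕ (color s₁ j)) (+-∸-assoc 1 1+k≤m′) (offline j<n e∋j)))

    stocked-entry : Stocked v swapped (entry c e (nodes s₁))
    stocked-entry = record
      { edge<bound = edge<
      ; bound≤     = ≤-refl
      ; sealed     = quiet⇒closed (Forced.valid r)
      ; token      = record
          { edge<   = edge<
          ; size≡   = trans size≡ (sym vc≡1+k)
          ; online  = online
          ; offline = λ {j} j<n e∋j → subst (λ a → m′ ∸ a ≤ toℕ (color swapped j)) (sym vc≡1+k)
                                              (proj₁ (recolored j<n e∋j)) }
      ; below-top  = λ j<n e∋j → proj₂ (recolored j<n e∋j) }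

    covers′ : ∀ c′ → lookup v c′ ≢ 0 → HasEntry (entry c e (nodes s₁) ∷ Harvest.entries H) c′ ⊎ c′ ∈ pending
    covers′ c′ vc′≢0 with Harvest.covers H c′ vc′≢0
    ... | inj₁ has         = inj₁ (there has)
    ... | inj₂ (here refl) = inj₁ (here refl)
    ... | inj₂ (there c′∈) = inj₂ c′∈

    harvest : Harvest s₀ v B pending
    harvest = record
      { state      = swapped
      ; valid      = swapped-valid
      ; extends    = ⊑-trans (Harvest.extends H) swapped-extends
      ; entries    = entry c e (nodes s₁) ∷ Harvest.entries H
      ; stocked    = stocked-entry ∷ All.map (Stocked-⊑ swapped-extends) (Harvest.stocked H)
      ; sorted     = All.map (λ ok → ≤-trans (Stocked.bound≤ ok) (Forced.new r)) (Harvest.stocked H) ∷ Harvest.sorted H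
      ; new        = ≤-trans (grows (Harvest.extends H)) (Forced.new r) ∷ Harvest.new H
      ; covers     = covers′
      ; affordable = ≤-trans (+-monoˡ-≤ _ (Forced.within r))
                             (≤-trans (≤-reflexive (+-assoc (nodes s) B _)) (Harvest.affordable H)) }

  Forcing : ℕ → Set
  Forcing f = ∀ v s → Valid s → Bounded v → sum v ≤ f → Forced s v (budget m f)

  update-bounded : ∀ {v c k} → Bounded v → lookup v c ≡ suc k → Bounded (v [ c ]≔ k)
  update-bounded {v} {c} {k} v<m vc≡1+k c′ with c′ F.≟ c
  ... | yes refl = subst (_< m) (sym (lookup∘update c v k)) (<-trans (n<1+n k) (subst (_< m) vc≡1+k (v<m c)))
  ... | no  c′≢c = subst (_< m) (sym (lookup∘update′ c′≢c v k)) (v<m c′)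

  harvest-step : ∀ {s₀ v f c pending} → Forcing f → Bounded v → sum v ≤ suc f →
    Harvest s₀ v (budget m f) (c ∷ pending) → Forced s₀ v (budget m (suc f)) ⊎ Harvest s₀ v (budget m f) pending
  harvest-step {s₀} {v} {f} {c} {pending} force-f v<m sum≤ H with lookup v c in vc
  ... | zero  = inj₂ (harvest-skip vc H)
  ... | suc k with force-f (v [ c ]≔ k) (Harvest.state H) (Harvest.valid H) (update-bounded {v} {c} v<m vc)
                           (≤-pred (subst (_≤ suc f) (sum-update v c vc) sum≤))
  ...   | r with Forced.hue r F.≟ c
  ...     | yes hue≡c = inj₂ (Stock.harvest vc v<m H r hue≡c)
  ...     | no  hue≢c = inj₁ (forced-rebase r (Harvest.extends H) room (lookup∘update′ hue≢c v k))
    where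
    room : nodes (Harvest.state H) + budget m f ≤ nodes s₀ + budget m (suc f)
    room = ≤-trans (+-monoʳ-≤ _ (m≤m+n (budget m f) (length pending * budget m f)))
                   (≤-trans (Harvest.affordable H) (+-monoʳ-≤ (nodes s₀) (n≤1+n _)))

  harvest-all : ∀ {s₀ v f} → Forcing f → Bounded v → sum v ≤ suc f → ∀ pending →
    Harvest s₀ v (budget m f) pending → Forced s₀ v (budget m (suc f)) ⊎ Harvest s₀ v (budget m f) []
  harvest-all force-f v<m sum≤ []              H = inj₂ H
  harvest-all force-f v<m sum≤ (c ∷ pending) H with harvest-step force-f v<m sum≤ H
  ... | inj₁ forced = inj₁ forced
  ... | inj₂ H′     = harvest-all force-f v<m sum≤ pending H′

  harvest-start : ∀ {s₀ v B} → Valid s₀ → Harvest s₀ v B (allFin m)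
  harvest-start {s₀} {B = B} valid = record
    { state = s₀ ; valid = valid ; extends = ⊑-refl valid ; entries = [] ; stocked = [] ; sorted = [] ; new = []
    ; covers = λ c _ → inj₂ (∈-allFin c)
    ; affordable = ≤-reflexive (cong (λ l → nodes s₀ + l * B) (length-tabulate {n = m} (λ c → c))) }

  harvest-none : ∀ {s₀ v} → Valid s₀ → sum v ≤ 0 → Harvest s₀ v 0 []
  harvest-none {s₀} {v} valid sum≤0 = record
    { state = s₀ ; valid = valid ; extends = ⊑-refl valid ; entries = [] ; stocked = [] ; sorted = [] ; new = []
    ; covers = λ c vc≢0 → ⊥-elim (vc≢0 (n≤0⇒n≡0 (≤-trans (lookup≤sum v c) sum≤0)))
    ; affordable = ≤-reflexive (cong (nodes s₀ +_) (sym (*-zeroʳ m))) }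

  force : ∀ f → Forcing f
  force zero    v s valid v<m sum≤0 =
    forced-rebase {v = v} {v′ = v} (final-move v<m (harvest-none valid sum≤0)) (⊑-refl valid)
                  (≤-reflexive (cong (λ a → nodes s + suc a) (*-zeroʳ m))) refl
  force (suc f) v s valid v<m sum≤ with harvest-all (force f) v<m sum≤ (allFin m) (harvest-start valid)
  ... | inj₁ forced = forced
  ... | inj₂ H      = final-move v<m H

size-edgeOf : ∀ n J i → size (edgeOf n J i) ≡ count (member J i) n
size-edgeOf n J i = countIn≡count (edgeOf n J i) _ (member J i) (λ k → trans (∧-identityʳ _) (lookup∘tabulate _ k))

load-edgeOf : ∀ {n m} J i (c : Coloring n m) (col : ℕ → Fin m) → (∀ k → lookup c k ≡ col (toℕ k)) → ∀ y →
  load c y (edgeOf n J i) ≡ count (λ k → member J i k ∧ colored col y k) n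
load-edgeOf {n} J i c col agree y =
  countIn≡count (edgeOf n J i) (λ k → does (lookup c k F.≟ y)) _
    (λ k → cong₂ _∧_ (lookup∘tabulate _ k) (cong (λ z → does (z F.≟ y)) (agree k)))

edgeOf∈hypergraphOf : ∀ {n J e} → e < n → edgeOf n J e ∈ hypergraphOf n J
edgeOf∈hypergraphOf {n} {J} e<n =
  subst (λ i → edgeOf n J i ∈ hypergraphOf n J) (toℕ-fromℕ< e<n) (∈-tabulate⁺ (fromℕ< e<n))

module Outcome (m′ : ℕ) (O : ℕ → Joins → Fin (suc m′)) (causal : Causal O) where
  open Adversary m′ O causal

  module _ {s : State} (valid : Valid s) where
    open Valid valid
    private
      E = hypergraphOf (nodes s) (joins s)

    valid-isHyperforest : IsHyperforest E
    valid-isHyperforest = hypergraphOf-isHyperforest earlier separated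

    valid-edgesAtMost : EdgesAtMost m E
    valid-edgesAtMost i = subst (_≤ m)
      (sym (trans (cong size (lookup-tabulate-toℕ (nodes s) (edgeOf (nodes s) (joins s)) i))
                  (size-edgeOf (nodes s) (joins s) (toℕ i))))
      (small (toℕ i))

    valid-OPT≤1 : OPT m E ≤ 1
    valid-OPT≤1 = ≤-trans (OPT≤makespan m E offline) (makespan-≤ E offline rainbow-load)
      where
      offline : Coloring (nodes s) m
      offline = tabulate (λ k → color s (toℕ k))
      rainbow-load : ∀ y e → e ∈ E → load offline y e ≤ 1
      rainbow-load y e e∈ with ∈-tabulate⁻ e∈
      ... | i , refl = subst (_≤ 1) (sym (load-edgeOf (joins s) (toℕ i) offline (color s) (lookup∘tabulate _) y))
                             (rainbow (toℕ i) y)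

    token-load : ∀ {e x size lo} → Token s e x size lo → (c : Coloring (nodes s) m) →
      (∀ k → lookup c k ≡ O (toℕ k) (joins s)) → size ≤ makespan E c
    token-load {e} {x} {size} token c agree =
      ≤-trans (≤-reflexive loadEq) (load≤makespan E c x (edgeOf∈hypergraphOf {J = joins s} edge<))
      where
      open Token token
      loadEq : size ≡ load c x (edgeOf (nodes s) (joins s) e)
      loadEq = sym (trans (load-edgeOf (joins s) e c (λ k → O k (joins s)) agree x)
                          (trans (count-cong (nodes s) all-x) size≡))
        where
        all-x : ∀ k → k < nodes s → (member (joins s) e k ∧ colored (λ k → O k (joins s)) x k) ≡ member (joins s) e k
        all-x k k<n with member (joins s) e k in e∋k
        ... | false = refl
        ... | true  = dec-true (O k (joins s) F.≟ x) (online k<n e∋k)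

view-causal : ∀ n J J′ (j : Fin n) → (∀ k i → k ≤ toℕ j → J k i ≡ J′ k i) →
  view (hypergraphOf n J) j ≡ view (hypergraphOf n J′) j
view-causal n J J′ j agree = cong (filterᵇ nonempty)
  (trans (map-tabulate {n = n} (edgeOf n J ∘ toℕ) (truncate j))
         (trans (List.tabulate-cong {n = n} (λ i → truncations-agree (toℕ i)))
                (sym (map-tabulate {n = n} (edgeOf n J′ ∘ toℕ) (truncate j)))))
  where
  truncations-agree : ∀ a → truncate j (edgeOf n J a) ≡ truncate j (edgeOf n J′ a)
  truncations-agree a = Vec.tabulate-cong λ k →
    let k′ = inject≤ k (toℕ<n j) in
    trans (lookup∘tabulate (member J a ∘ toℕ) k′)
      (trans (cong (λ b → (a ≡ᵇ toℕ k′) ∨ b)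
                   (agree (toℕ k′) a (subst (_≤ toℕ j) (sym (toℕ-inject≤ k (toℕ<n j))) (≤-pred (toℕ<n k)))))
             (sym (lookup∘tabulate (member J′ a ∘ toℕ) k′)))

-- Past node N the oracle's answer is junk; the adversary only asks about nodes below N.
oracle : ∀ {m′} → ℕ → OnlineAlg (suc m′) → ℕ → Joins → Fin (suc m′)
oracle N A k J with k <? N
... | yes k<N = A (toℕ (fromℕ< k<N)) (view (hypergraphOf N J) (fromℕ< k<N))
... | no  _   = fzero

oracle-causal : ∀ {m′} N (A : OnlineAlg (suc m′)) → Causal (oracle N A)
oracle-causal N A k J J′ agree with k <? N
... | yes k<N = cong (A (toℕ (fromℕ< k<N))) (view-causal N J J′ (fromℕ< k<N)
                  (λ k′ i k′≤ → agree k′ i (subst (k′ ≤_) (toℕ-fromℕ< k<N) k′≤)))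
... | no  _   = refl

runAlg≡oracle : ∀ {m′ n N} (A : OnlineAlg (suc m′)) J → n ≡ N → (j : Fin n) →
  lookup (runAlg A (hypergraphOf n J)) j ≡ oracle N A (toℕ j) J
runAlg≡oracle {N = N} A J refl j with toℕ j <? N
... | yes j<N rewrite fromℕ<-toℕ j j<N = lookup∘tabulate _ j
... | no  j≮N = ⊥-elim (j≮N (toℕ<n j))

adversary : ∀ m′ (A : OnlineAlg (suc m′)) → let m = suc m′ ; N = budget m (m * m′) in
  Σ (Hypergraph N) λ E → IsHyperforest E × EdgesAtMost m E × m ≤ ALG A E × OPT m E ≤ 1
adversary m′ A = subst (λ n → Σ (Hypergraph n) λ E → IsHyperforest E × EdgesAtMost m E × m ≤ ALG A E × OPT m E ≤ 1)
  nodes-final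
  ( hypergraphOf (nodes final) (joins final) , valid-isHyperforest final-valid , valid-edgesAtMost final-valid
  , token-load final-valid final-token (runAlg A (hypergraphOf (nodes final) (joins final)))
               (runAlg≡oracle A (joins final) nodes-final)
  , valid-OPT≤1 final-valid )
  where
  m = suc m′
  N = budget m (m * m′)
  open Adversary m′ (oracle N A) (oracle-causal N A) hiding (m)
  open Outcome m′ (oracle N A) (oracle-causal N A)

  r : Forced empty (replicate m m′) N
  r = force (m * m′) (replicate m m′) empty empty-valid (λ c → subst (_< m) (sym (lookup-replicate c m′)) ≤-refl)
            (≤-reflexive (sum-replicate m m′))

  padding = N ∸ nodes (Forced.state r)
  final   = pad (Forced.state r) padding

  final-valid : Valid final
  final-valid = proj₁ (pad-valid padding (Forced.valid r))

  nodes-final : nodes final ≡ N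
  nodes-final = trans (nodes-pad _ padding) (m∸n+n≡m (Forced.within r))

  lo = m′ ∸ lookup (replicate m m′) (Forced.hue r)

  final-token : Token final (Forced.edge r) (Forced.hue r) m lo
  final-token = subst (λ a → Token final (Forced.edge r) (Forced.hue r) (suc a) lo) (lookup-replicate (Forced.hue r) m′)
                  (Token-⊑ (proj₂ (pad-valid padding (Forced.valid r))) (Forced.token r))

budget≤pow : ∀ m f → budget m f ≤ suc m ^ f
budget≤pow m zero    = ≤-refl
budget≤pow m (suc f) = +-mono-≤ (m^n>0 (suc m) f) (*-monoʳ-≤ m (budget≤pow m f))

m≤m^n : ∀ m .{{_ : NonZero m}} n → 1 ≤ n → m ≤ m ^ n
m≤m^n m (suc n) _ = ≤-trans (≤-reflexive (sym (*-identityʳ m))) (*-monoʳ-≤ m (m^n>0 m n))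

budget≤tower5 : ∀ m′ → let m = suc m′ in budget m (m * m′) ≤ tower5 (2 * m + 1)
budget≤tower5 m′ = ≤-trans (budget≤pow m (m * m′)) (≤-trans (^-monoˡ-≤ (m * m′) m+1≤x) (^-monoʳ-≤ x exponent))
  where
  m = suc m′
  x = 2 * m + 1
  m+1≤x : suc m ≤ x
  m+1≤x = ≤-trans (s≤s (m≤m+n m (m + 0))) (≤-reflexive (+-comm 1 (2 * m)))
  m≤x : m ≤ x
  m≤x = ≤-trans (n≤1+n m) m+1≤x
  exponent : m * m′ ≤ x ^ (x ^ (x ^ x))
  exponent = ≤-trans (*-mono-≤ m≤x (≤-trans (n≤1+n m′) m≤x))
    (≤-trans (≤-reflexive (cong (x *_) (sym (*-identityʳ x))))
      (^-monoʳ-≤ x {2} (≤-trans (≤-trans (s≤s (s≤s z≤n)) m+1≤x) (m≤m^n x (x ^ x) (m^n>0 x x)))))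

mainTheorem11 : (m : ℕ) → 1 ≤ m →
    Σ ℕ λ N → (N ≤ tower5 (2 * m + 1)) ×
      ((ε : ℚ) → Positive ε → (A : OnlineAlg m) →
        ¬ ((E : Hypergraph N) → IsHyperforest E → EdgesAtMost m E →
             ℕ→ℚ (ALG A E) ≤ℚ ((ℕ→ℚ m - ε) *ℚ ℕ→ℚ (OPT m E))))
mainTheorem11 (suc m′) _ = budget (suc m′) (suc m′ * m′) , budget≤tower5 m′ , λ ε ε>0 A competitive →
  let E , forest , small , m≤ALG , OPT≤1 = adversary m′ A in
  m≤a⇒o≤1⇒a≰[m-ε]*o ε ε>0 (s≤s z≤n) m≤ALG OPT≤1 (competitive E forest small)
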